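{- Let $m,a,b$ be positive integers with $m\ge a+b$ and $a\ge b$. Then $$\sum_{s=a}^{a+b}\binom{m}{s}\binom{s}{a+b-s}\frac{1}{s-b+1}\binom{2s-a-b}{s-a}=\frac{1}{m+1}\binom{m+1}{a+1}\binom{m+1}{b}.$$ -}

module Defs where

open import Data.Nat using (ℕ; zero; suc; _+_; _∸_; _*_)
open import Data.Nat.Combinatorics using (_C_)
open import Data.Integer using (+_)
open import Data.Rational using (ℚ; _/_) renaming (_+_ to _+ℚ_)
import Data.Rational as ℚ

sumTo : ℕ → (ℕ → ℚ) → ℚ
sumTo zero    f = f 0
sumTo (suc n) f = sumTo n f +ℚ f (suc n)

term : ℕ → ℕ → ℕ → ℕ → ℚ
term m a b s =
  (+ ((m C s) * (s C ((a + b) ∸ s)) * (((s + s) ∸ (a + b)) C (s ∸ a)))) / suc (s ∸ b)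

-- LHS: Σ_{s=a}^{a+b} term s, reindexed as s = a + i, i = 0..b
lhs : ℕ → ℕ → ℕ → ℚ
lhs m a b = sumTo b (λ i → term m a b (a + i))

rhs : ℕ → ℕ → ℕ → ℚ
rhs m a b = (+ ((suc m C suc a) * (suc m C b))) / suc m

-- Write the summation index as s = a + i (0 ≤ i ≤ b) and split the hypotheses
-- as b = i + j, a = b + c, m = a + b + r.  With
--   α = i,  β = j,  γ = c + i,  δ = j + r
-- we get m = α+β+γ+δ, s = α+β+γ, a+b−s = β, 2s−a−b = α+γ, s−a = α, s−b = γ,
-- so the i-th summand is  C(m, α+β+γ) C(α+β+γ, β) C(α+γ, α) / (γ+1).
-- The product of binomials is the multinomial coefficient m!/(α!β!γ!δ!), which
-- also equals C(α+β, α) C(γ+δ, γ) C(m, α+β); two absorption identities then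
-- turn the summand into  C(b, i) C(m+1−b, a−b+1+i) C(m+1, b) / (m+1).
-- All summands now share the denominator m+1, and Vandermonde's convolution
--   Σ_{i=0}^{b} C(b, i) C(n, t+i) = C(b+n, b+t),  with n = m+1−b, t = a−b+1,
-- sums the numerators to C(m+1, a+1) C(m+1, b).
module Submission where

open import Defs
open import Data.Nat using (ℕ; zero; suc; _+_; _*_; _∸_; _≤_; _≥_; _>_; _!; z≤n)
open import Data.Nat.Properties
open import Data.Nat.Combinatorics
  using (_C_; nCk≡n!/k![n-k]!; k![n∸k]!∣n!; nCk+nC[k+1]≡[n+1]C[k+1]; k>n⇒nCk≡0)
open import Data.Nat.DivMod using (m/n*n≡m)
open import Data.Nat.Tactic.RingSolver using (solve-∀)
open import Data.Integer using (+_)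
import Data.Integer as ℤ
import Data.Integer.Properties as ℤ
import Data.Integer.Tactic.RingSolver as ℤ-Solver
open import Data.Rational using (ℚ; _/_) renaming (_+_ to _+ℚ_)
open import Data.Rational.Properties
  using (fromℚᵘ-cong; toℚᵘ-injective; toℚᵘ-fromℚᵘ; toℚᵘ-homo-+)
open import Data.Rational.Base using (toℚᵘ)
open import Data.Rational.Unnormalised.Base using (mkℚᵘ; *≡*)
  renaming (_+_ to _+ᵘ_; _≃_ to _≃ᵘ_)
import Data.Rational.Unnormalised.Properties as ℚᵘ
open import Relation.Binary.PropositionalEquality
open ≡-Reasoning

sumℕ : ℕ → (ℕ → ℕ) → ℕ
sumℕ zero    f = f 0
sumℕ (suc n) f = sumℕ n f + f (suc n)

sumℕ-cong : ∀ n (f g : ℕ → ℕ) → (∀ i → f i ≡ g i) → sumℕ n f ≡ sumℕ n g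
sumℕ-cong zero    f g f≗g = f≗g 0
sumℕ-cong (suc n) f g f≗g = cong₂ _+_ (sumℕ-cong n f g f≗g) (f≗g (suc n))

sumℕ-*ʳ : ∀ n f c → sumℕ n (λ i → f i * c) ≡ sumℕ n f * c
sumℕ-*ʳ zero    f c = refl
sumℕ-*ʳ (suc n) f c = begin
  sumℕ n (λ i → f i * c) + f (suc n) * c ≡⟨ cong (_+ f (suc n) * c) (sumℕ-*ʳ n f c) ⟩
  sumℕ n f * c + f (suc n) * c           ≡⟨ *-distribʳ-+ c (sumℕ n f) (f (suc n)) ⟨
  (sumℕ n f + f (suc n)) * c             ∎

sumℕ-+ : ∀ n f g → sumℕ n (λ i → f i + g i) ≡ sumℕ n f + sumℕ n g
sumℕ-+ zero    f g = refl
sumℕ-+ (suc n) f g = begin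
  sumℕ n (λ i → f i + g i) + (f (suc n) + g (suc n))
    ≡⟨ cong (_+ (f (suc n) + g (suc n))) (sumℕ-+ n f g) ⟩
  (sumℕ n f + sumℕ n g) + (f (suc n) + g (suc n))
    ≡⟨ interchange (sumℕ n f) (sumℕ n g) (f (suc n)) (g (suc n)) ⟩
  (sumℕ n f + f (suc n)) + (sumℕ n g + g (suc n)) ∎
  where
  interchange : ∀ w x y z → (w + x) + (y + z) ≡ (w + y) + (x + z)
  interchange = solve-∀

sumℕ-peel : ∀ n f → sumℕ (suc n) f ≡ f 0 + sumℕ n (λ i → f (suc i))
sumℕ-peel zero    f = refl
sumℕ-peel (suc n) f = begin
  sumℕ (suc n) f + f (suc (suc n))                    ≡⟨ cong (_+ f (suc (suc n))) (sumℕ-peel n f) ⟩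
  f 0 + sumℕ n (λ i → f (suc i)) + f (suc (suc n))    ≡⟨ +-assoc (f 0) _ _ ⟩
  f 0 + (sumℕ n (λ i → f (suc i)) + f (suc (suc n)))  ∎

pascal-sum : ∀ b (g : ℕ → ℕ) →
  sumℕ (suc b) (λ i → (suc b C i) * g i)
  ≡ sumℕ b (λ i → (b C i) * g i) + sumℕ b (λ i → (b C i) * g (suc i))
pascal-sum b g = begin
  sumℕ (suc b) (λ i → (suc b C i) * g i)
    ≡⟨ sumℕ-peel b _ ⟩
  1 * g 0 + sumℕ b (λ i → (suc b C suc i) * g (suc i))
    ≡⟨ cong (_+_ (1 * g 0)) (sumℕ-cong b _ _ pascal-term) ⟩
  1 * g 0 + sumℕ b (λ i → (b C i) * g (suc i) + (b C suc i) * g (suc i))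
    ≡⟨ cong (_+_ (1 * g 0)) (sumℕ-+ b _ _) ⟩
  1 * g 0 + (shifted + sumℕ b (λ i → (b C suc i) * g (suc i)))
    ≡⟨ swap-last (1 * g 0) shifted _ ⟩
  (1 * g 0 + sumℕ b (λ i → (b C suc i) * g (suc i))) + shifted
    ≡⟨ cong (_+ shifted) (sumℕ-peel b (λ i → (b C i) * g i)) ⟨
  (sumℕ b (λ i → (b C i) * g i) + (b C suc b) * g (suc b)) + shifted
    ≡⟨ cong (λ z → sumℕ b (λ i → (b C i) * g i) + z * g (suc b) + shifted) (k>n⇒nCk≡0 (n<1+n b)) ⟩
  (sumℕ b (λ i → (b C i) * g i) + 0) + shifted
    ≡⟨ cong (_+ shifted) (+-identityʳ _) ⟩
  sumℕ b (λ i → (b C i) * g i) + shifted ∎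
  where
  shifted : ℕ
  shifted = sumℕ b (λ i → (b C i) * g (suc i))
  pascal-term : ∀ i → (suc b C suc i) * g (suc i) ≡ (b C i) * g (suc i) + (b C suc i) * g (suc i)
  pascal-term i = trans (cong (_* g (suc i)) (sym (nCk+nC[k+1]≡[n+1]C[k+1] b i)))
                        (*-distribʳ-+ (g (suc i)) (b C i) (b C suc i))
  swap-last : ∀ x y z → x + (y + z) ≡ (x + z) + y
  swap-last = solve-∀

vandermonde : ∀ b n t → sumℕ b (λ i → (b C i) * (n C (t + i))) ≡ (b + n) C (b + t)
vandermonde zero    n t = trans (+-identityʳ _) (cong (n C_) (+-identityʳ t))
vandermonde (suc b) n t = begin
  sumℕ (suc b) (λ i → (suc b C i) * (n C (t + i)))
    ≡⟨ pascal-sum b (λ i → n C (t + i)) ⟩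
  sumℕ b (λ i → (b C i) * (n C (t + i))) + sumℕ b (λ i → (b C i) * (n C (t + suc i)))
    ≡⟨ cong₂ _+_ (vandermonde b n t) (trans (sumℕ-cong b _ _ shift-index) (vandermonde b n (suc t))) ⟩
  (b + n) C (b + t) + (b + n) C (b + suc t)
    ≡⟨ cong (λ z → (b + n) C (b + t) + (b + n) C z) (+-suc b t) ⟩
  (b + n) C (b + t) + (b + n) C suc (b + t)
    ≡⟨ nCk+nC[k+1]≡[n+1]C[k+1] (b + n) (b + t) ⟩
  suc (b + n) C suc (b + t) ∎
  where
  shift-index : ∀ i → (b C i) * (n C (t + suc i)) ≡ (b C i) * (n C (suc t + i))
  shift-index i = cong (λ z → (b C i) * (n C z)) (+-suc t i)

binomial-factorials : ∀ {n} k l → n ≡ k + l → (n C k) * (k ! * l !) ≡ n !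
binomial-factorials {n} k l refl = begin
  (n C k) * (k ! * l !)
    ≡⟨ cong (λ z → (n C k) * (k ! * z !)) (m+n∸m≡n k l) ⟨
  (n C k) * (k ! * (n ∸ k) !)
    ≡⟨ cong (_* (k ! * (n ∸ k) !)) (nCk≡n!/k![n-k]! k≤n) ⟩
  _
    ≡⟨ m/n*n≡m {{k !* (n ∸ k) !≢0}} (k![n∸k]!∣n! k≤n) ⟩
  n ! ∎
  where
  k≤n : k ≤ n
  k≤n = m≤m+n k l

-- Both products count the splittings of an m-set into labelled blocks of sizes
-- α, β, γ, δ: each times α!β!γ!δ! is m!.
multinomial : ∀ α β γ δ →
  let s = α + β + γ ; m = s + δ in
  (m C s) * (s C β) * ((α + γ) C α) ≡ ((α + β) C α) * ((γ + δ) C γ) * (m C (α + β))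
multinomial α β γ δ =
  *-cancelʳ-≡ _ _ (α ! * β ! * (γ ! * δ !)) {{m*n≢0 _ _ {{α !* β !≢0}} {{γ !* δ !≢0}}}}
    (trans left-count (sym right-count))
  where
  s m : ℕ
  s = α + β + γ
  m = s + δ
  left-count : (m C s) * (s C β) * ((α + γ) C α) * (α ! * β ! * (γ ! * δ !)) ≡ m !
  left-count = begin
    (m C s) * (s C β) * ((α + γ) C α) * (α ! * β ! * (γ ! * δ !))
      ≡⟨ regroup (m C s) (s C β) ((α + γ) C α) (α !) (β !) (γ !) (δ !) ⟩
    (m C s) * ((s C β) * (β ! * (((α + γ) C α) * (α ! * γ !))) * δ !)
      ≡⟨ cong (λ z → (m C s) * ((s C β) * (β ! * z) * δ !)) (binomial-factorials α γ refl) ⟩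
    (m C s) * ((s C β) * (β ! * (α + γ) !) * δ !)
      ≡⟨ cong (λ z → (m C s) * (z * δ !)) (binomial-factorials β (α + γ) (s≡β+[α+γ] α β γ)) ⟩
    (m C s) * (s ! * δ !)
      ≡⟨ binomial-factorials s δ refl ⟩
    m ! ∎
    where
    regroup : ∀ x y z a b c d → x * y * z * (a * b * (c * d)) ≡ x * (y * (b * (z * (a * c))) * d)
    regroup = solve-∀
    s≡β+[α+γ] : ∀ α β γ → α + β + γ ≡ β + (α + γ)
    s≡β+[α+γ] = solve-∀
  right-count : ((α + β) C α) * ((γ + δ) C γ) * (m C (α + β)) * (α ! * β ! * (γ ! * δ !)) ≡ m !
  right-count = begin
    ((α + β) C α) * ((γ + δ) C γ) * (m C (α + β)) * (α ! * β ! * (γ ! * δ !))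
      ≡⟨ regroup ((α + β) C α) ((γ + δ) C γ) (m C (α + β)) (α !) (β !) (γ !) (δ !) ⟩
    (m C (α + β)) * (((α + β) C α) * (α ! * β !) * (((γ + δ) C γ) * (γ ! * δ !)))
      ≡⟨ cong₂ (λ u v → (m C (α + β)) * (u * v)) (binomial-factorials α β refl) (binomial-factorials γ δ refl) ⟩
    (m C (α + β)) * ((α + β) ! * (γ + δ) !)
      ≡⟨ binomial-factorials (α + β) (γ + δ) (+-assoc (α + β) γ δ) ⟩
    m ! ∎
    where
    regroup : ∀ x y z a b c d → x * y * z * (a * b * (c * d)) ≡ z * (x * (a * b) * (y * (c * d)))
    regroup = solve-∀

absorptionˡ : ∀ {n} k l → n ≡ k + l → suc k * (suc n C suc k) ≡ suc n * (n C k)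
absorptionˡ {n} k l n≡k+l = *-cancelʳ-≡ _ _ (k ! * l !) {{k !* l !≢0}} (begin
  suc k * (suc n C suc k) * (k ! * l !)  ≡⟨ regroup (suc k) (suc n C suc k) (k !) (l !) ⟩
  (suc n C suc k) * (suc k ! * l !)      ≡⟨ binomial-factorials (suc k) l (cong suc n≡k+l) ⟩
  suc n * n !                            ≡⟨ cong (suc n *_) (binomial-factorials k l n≡k+l) ⟨
  suc n * ((n C k) * (k ! * l !))        ≡⟨ *-assoc (suc n) (n C k) (k ! * l !) ⟨
  suc n * (n C k) * (k ! * l !)          ∎)
  where
  regroup : ∀ x c a b → x * c * (a * b) ≡ c * (x * a * b)
  regroup = solve-∀

absorptionʳ : ∀ {n} k l → n ≡ k + l → suc l * (suc n C k) ≡ suc n * (n C k)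
absorptionʳ {n} k l n≡k+l = *-cancelʳ-≡ _ _ (k ! * l !) {{k !* l !≢0}} (begin
  suc l * (suc n C k) * (k ! * l !)  ≡⟨ regroup (suc l) (suc n C k) (k !) (l !) ⟩
  (suc n C k) * (k ! * suc l !)      ≡⟨ binomial-factorials k (suc l) (trans (cong suc n≡k+l) (sym (+-suc k l))) ⟩
  suc n * n !                        ≡⟨ cong (suc n *_) (binomial-factorials k l n≡k+l) ⟨
  suc n * ((n C k) * (k ! * l !))    ≡⟨ *-assoc (suc n) (n C k) (k ! * l !) ⟨
  suc n * (n C k) * (k ! * l !)      ∎)
  where
  regroup : ∀ x c a b → x * c * (a * b) ≡ c * (a * (x * b))
  regroup = solve-∀

summand-numerators : ∀ α β γ δ {s m} → s ≡ α + β + γ → m ≡ s + δ →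
  (m C s) * (s C β) * ((α + γ) C α) * suc m
  ≡ ((α + β) C α) * (suc (γ + δ) C suc γ) * (suc m C (α + β)) * suc γ
summand-numerators α β γ δ {s} {m} refl refl = begin
  (m C s) * (s C β) * ((α + γ) C α) * suc m
    ≡⟨ cong (_* suc m) (multinomial α β γ δ) ⟩
  A * G * M * suc m
    ≡⟨ regroup₁ A G M (suc m) ⟩
  A * G * (suc m * M)
    ≡⟨ cong (A * G *_) (absorptionʳ (α + β) (γ + δ) (+-assoc (α + β) γ δ)) ⟨
  A * G * (suc (γ + δ) * M′)
    ≡⟨ regroup₂ A G (suc (γ + δ)) M′ ⟩
  A * (suc (γ + δ) * G) * M′
    ≡⟨ cong (λ z → A * z * M′) (absorptionˡ γ δ refl) ⟨
  A * (suc γ * G′) * M′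
    ≡⟨ regroup₃ A (suc γ) G′ M′ ⟩
  A * G′ * M′ * suc γ ∎
  where
  A G G′ M M′ : ℕ
  A = (α + β) C α
  G = (γ + δ) C γ
  G′ = suc (γ + δ) C suc γ
  M = m C (α + β)
  M′ = suc m C (α + β)
  regroup₁ : ∀ a g x y → a * g * x * y ≡ a * g * (y * x)
  regroup₁ = solve-∀
  regroup₂ : ∀ a g x y → a * g * (x * y) ≡ a * (x * g) * y
  regroup₂ = solve-∀
  regroup₃ : ∀ a x g y → a * (x * g) * y ≡ a * g * y * x
  regroup₃ = solve-∀

-- frac x d is the rational x / (d+1); every denominator in Defs has this form.
frac : ℕ → ℕ → ℚ
frac x d = + x / suc d

frac-cross : ∀ x d y e → x * suc e ≡ y * suc d → frac x d ≡ frac y e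
frac-cross x d y e eq = fromℚᵘ-cong {mkℚᵘ (+ x) d} {mkℚᵘ (+ y) e}
  (*≡* (trans (sym (ℤ.pos-* x (suc e))) (trans (cong +_ eq) (ℤ.pos-* y (suc d)))))

same-denominator-+ : ∀ x y d → mkℚᵘ (+ x) d +ᵘ mkℚᵘ (+ y) d ≃ᵘ mkℚᵘ (+ (x + y)) d
same-denominator-+ x y d = *≡* (begin
  (+ x ℤ.* D ℤ.+ + y ℤ.* D) ℤ.* D      ≡⟨ factor (+ x) (+ y) D ⟩
  (+ x ℤ.+ + y) ℤ.* (D ℤ.* D)          ≡⟨ cong₂ ℤ._*_ (ℤ.pos-+ x y) (ℤ.pos-* (suc d) (suc d)) ⟨
  + (x + y) ℤ.* + (suc d * suc d)      ∎)
  where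
  D : ℤ.ℤ
  D = + suc d
  factor : ∀ X Y E → (X ℤ.* E ℤ.+ Y ℤ.* E) ℤ.* E ≡ (X ℤ.+ Y) ℤ.* (E ℤ.* E)
  factor = ℤ-Solver.solve-∀

frac-+ : ∀ x y d → frac x d +ℚ frac y d ≡ frac (x + y) d
frac-+ x y d = toℚᵘ-injective (begin≃
  toℚᵘ (frac x d +ℚ frac y d)             ≈⟨ toℚᵘ-homo-+ (frac x d) (frac y d) ⟩
  toℚᵘ (frac x d) +ᵘ toℚᵘ (frac y d)      ≈⟨ ℚᵘ.+-cong (toℚᵘ-fromℚᵘ (mkℚᵘ (+ x) d)) (toℚᵘ-fromℚᵘ (mkℚᵘ (+ y) d)) ⟩
  mkℚᵘ (+ x) d +ᵘ mkℚᵘ (+ y) d            ≈⟨ same-denominator-+ x y d ⟩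
  mkℚᵘ (+ (x + y)) d                      ≈⟨ toℚᵘ-fromℚᵘ (mkℚᵘ (+ (x + y)) d) ⟨
  toℚᵘ (frac (x + y) d)                   ∎≃)
  where open ℚᵘ.≃-Reasoning renaming (begin_ to begin≃_; _∎ to _∎≃)

sumTo-frac : ∀ n f d → sumTo n (λ i → frac (f i) d) ≡ frac (sumℕ n f) d
sumTo-frac zero    f d = refl
sumTo-frac (suc n) f d = trans (cong (_+ℚ frac (f (suc n)) d) (sumTo-frac n f d))
                               (frac-+ (sumℕ n f) (f (suc n)) d)

sumTo-cong : ∀ n (f g : ℕ → ℚ) → (∀ i → i ≤ n → f i ≡ g i) → sumTo n f ≡ sumTo n g
sumTo-cong zero    f g f≗g = f≗g 0 z≤n
sumTo-cong (suc n) f g f≗g =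
  cong₂ _+ℚ_ (sumTo-cong n f g (λ i i≤n → f≗g i (m≤n⇒m≤1+n i≤n))) (f≗g (suc n) ≤-refl)

∸-by : ∀ {x} y z → x ≡ y + z → x ∸ y ≡ z
∸-by y z refl = m+n∸m≡n y z

summand-closed : ∀ {m a b} i j c r → b ≡ i + j → a ≡ b + c → m ≡ a + b + r →
  term m a b (a + i) ≡ frac ((b C i) * ((suc m ∸ b) C (suc (a ∸ b) + i)) * (suc m C b)) m
summand-closed {m} {a} {b} i j c r refl refl refl = begin
  frac ((m C s) * (s C ((a + b) ∸ s)) * (((s + s) ∸ (a + b)) C (s ∸ a))) (s ∸ b)
    ≡⟨ cong₄ (λ x y z w → frac ((m C s) * (s C x) * (y C z)) w)
         (∸-by s j (a+b≡s+β i j c)) (∸-by (a + b) (i + γ) (2s≡a+b+[α+γ] i j c)) (∸-by a i refl)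
         (∸-by b γ (s≡b+γ i j c)) ⟩
  frac multinomial-form γ
    ≡⟨ frac-cross multinomial-form γ absorbed-form m (summand-numerators i j γ δ (s≡b+γ i j c) (m≡s+δ i j c r)) ⟩
  frac absorbed-form m
    ≡⟨ cong₂ (λ x y → frac ((b C i) * (x C y) * (suc m C b)) m)
         (∸-by b (suc (γ + δ)) (1+m≡b+[1+γ+δ] i j c r)) (cong (λ z → suc z + i) (m+n∸m≡n b c)) ⟨
  frac ((b C i) * ((suc m ∸ b) C (suc (a ∸ b) + i)) * (suc m C b)) m ∎
  where
  s γ δ : ℕ
  s = a + i
  γ = c + i
  δ = j + r
  multinomial-form absorbed-form : ℕ
  multinomial-form = (m C s) * (s C j) * ((i + γ) C i)
  absorbed-form = (b C i) * (suc (γ + δ) C suc γ) * (suc m C b)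
  cong₄ : ∀ {A : Set} (f : ℕ → ℕ → ℕ → ℕ → A) {x x′ y y′ z z′ w w′} →
    x ≡ x′ → y ≡ y′ → z ≡ z′ → w ≡ w′ → f x y z w ≡ f x′ y′ z′ w′
  cong₄ f refl refl refl refl = refl
  a+b≡s+β : ∀ i j c → i + j + c + (i + j) ≡ i + j + c + i + j
  a+b≡s+β = solve-∀
  2s≡a+b+[α+γ] : ∀ i j c → i + j + c + i + (i + j + c + i) ≡ i + j + c + (i + j) + (i + (c + i))
  2s≡a+b+[α+γ] = solve-∀
  s≡b+γ : ∀ i j c → i + j + c + i ≡ i + j + (c + i)
  s≡b+γ = solve-∀
  m≡s+δ : ∀ i j c r → i + j + c + (i + j) + r ≡ i + j + c + i + (j + r)
  m≡s+δ = solve-∀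
  1+m≡b+[1+γ+δ] : ∀ i j c r → suc (i + j + c + (i + j) + r) ≡ i + j + suc (c + i + (j + r))
  1+m≡b+[1+γ+δ] = solve-∀

lemma9 : (m a b : ℕ) → m > 0 → a > 0 → b > 0 → m ≥ a + b → a ≥ b →
    lhs m a b ≡ rhs m a b
lemma9 m a b _ _ _ a+b≤m b≤a = begin
  sumTo b (λ i → term m a b (a + i))
    ≡⟨ sumTo-cong b _ _ (λ i i≤b → summand-closed i (b ∸ i) (a ∸ b) (m ∸ (a + b))
         (sym (m+[n∸m]≡n i≤b)) (sym (m+[n∸m]≡n b≤a)) (sym (m+[n∸m]≡n a+b≤m))) ⟩
  sumTo b (λ i → frac (summand i * (suc m C b)) m)
    ≡⟨ sumTo-frac b (λ i → summand i * (suc m C b)) m ⟩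
  frac (sumℕ b (λ i → summand i * (suc m C b))) m
    ≡⟨ cong (λ z → frac z m) (sumℕ-*ʳ b summand (suc m C b)) ⟩
  frac (sumℕ b summand * (suc m C b)) m
    ≡⟨ cong (λ z → frac (z * (suc m C b)) m) (vandermonde b n t) ⟩
  frac (((b + n) C (b + t)) * (suc m C b)) m
    ≡⟨ cong₂ (λ x y → frac ((x C y) * (suc m C b)) m) (m+[n∸m]≡n b≤1+m) b+t≡1+a ⟩
  frac ((suc m C suc a) * (suc m C b)) m ∎
  where
  n t : ℕ
  n = suc m ∸ b
  t = suc (a ∸ b)
  summand : ℕ → ℕ
  summand i = (b C i) * (n C (t + i))
  b≤1+m : b ≤ suc m
  b≤1+m = ≤-trans (m≤n+m b a) (m≤n⇒m≤1+n a+b≤m)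
  b+t≡1+a : b + t ≡ suc a
  b+t≡1+a = trans (+-suc b (a ∸ b)) (cong suc (m+[n∸m]≡n b≤a))
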